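{- Let $G=(V,E)$ be a finite connected simple graph, let $v,w\in V$, and let $p$ be a shortest $v$-$w$-path in $G$. Then, for each of the two choices "$v\in R$" or "$v\notin R$", there exists an independent set $R\subseteq V$ satisfying that choice such that (i) the bipartite graph $G(R,V\setminus R)$ is connected, and (ii) the path $p$ alternates between $R$ and $V\setminus R$, i.e., any two consecutive vertices of $p$ lie in different sets among $R$ and $V\setminus R$.
   Context: For disjoint $S,T\subseteq V$, $G(S,T)$ denotes the bipartite subgraph of $G$ with vertex set $S\cup T$ whose edges are exactly the edges of $G$ having one endpoint in $S$ and the other in $T$. -}

module Defs where

open import Data.Nat using (ℕ; suc; _≤_)
open import Data.Fin using (Fin)
open import Data.Bool using (Bool; true; false; T; _∧_; _xor_)
open import Data.Vec using (lookup)
open import Data.Fin.Subset using (Subset)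
open import Data.List using (List; _∷_; [])
open import Data.List.Relation.Unary.Unique.Propositional using (Unique)
open import Data.Product using (_×_)
open import Data.Unit using (⊤)
open import Relation.Binary.PropositionalEquality using (_≡_; _≢_)
open import Relation.Nullary using (¬_)

record SimpleGraph (n : ℕ) : Set where
  field
    adj   : Fin n → Fin n → Bool
    sym   : ∀ u v → adj u v ≡ adj v u
    loopless : ∀ v → adj v v ≡ false
open SimpleGraph public

data Walk {n : ℕ} (A : Fin n → Fin n → Bool) : Fin n → Fin n → Set where
  [_]    : (v : Fin n) → Walk A v v
  _∷⟨_⟩_ : (u : Fin n) {v w : Fin n} → T (A u v) → Walk A v w → Walk A u w

module _ {n : ℕ} {A : Fin n → Fin n → Bool} where
  vertices : ∀ {u w} → Walk A u w → List (Fin n)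
  vertices [ v ] = v ∷ []
  vertices (u ∷⟨ _ ⟩ q) = u ∷ vertices q

  len : ∀ {u w} → Walk A u w → ℕ
  len [ v ] = 0
  len (u ∷⟨ _ ⟩ q) = suc (len q)

  IsPath : ∀ {u w} → Walk A u w → Set
  IsPath p = Unique (vertices p)

  IsShortestPath : ∀ {u w} → Walk A u w → Set
  IsShortestPath {u} {w} p = IsPath p × (∀ (q : Walk A u w) → IsPath q → len p ≤ len q)

  Alternates : Subset n → ∀ {u w} → Walk A u w → Set
  Alternates R [ v ] = ⊤
  Alternates R (_∷⟨_⟩_ u {v} _ q) = (lookup R u ≢ lookup R v) × Alternates R q

ConnectedAdj : {n : ℕ} → (Fin n → Fin n → Bool) → Set
ConnectedAdj {n} A = ∀ (u v : Fin n) → Walk A u v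

Connected : {n : ℕ} → SimpleGraph n → Set
Connected G = ConnectedAdj (adj G)

Independent : {n : ℕ} → SimpleGraph n → Subset n → Set
Independent G R = ∀ u v → lookup R u ≡ true → lookup R v ≡ true → ¬ T (adj G u v)

-- adjacency of the bipartite subgraph G(R, V ∖ R): vertex set R ∪ (V ∖ R) = V,
-- edges of G with exactly one endpoint in R
bipAdj : {n : ℕ} → SimpleGraph n → Subset n → Fin n → Fin n → Bool
bipAdj G R u v = adj G u v ∧ (lookup R u xor lookup R v)

{-# OPTIONS --safe #-}
module Submission where

open import Defs hiding (sym)
open import Data.Nat using (ℕ; zero; suc; _+_; _∸_; _≤_; _<_; z≤n; s≤s)
open import Data.Nat.Properties
  using (≤-refl; ≤-reflexive; ≤-trans; m≤n⇒m≤1+n; +-suc; +-comm; +-mono-≤; +-cancelˡ-≤;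
         +-identityʳ; m≤n+m; m∸n+n≡m; <⇒≱; module ≤-Reasoning)
open import Data.Fin using (Fin; _≟_)
open import Data.Fin.Properties using (any?; all?; ¬∀⟶∃¬)
open import Data.Fin.Subset using (Subset; ∣_∣)
open import Data.Fin.Subset.Properties using (∣p∣≤n)
open import Data.Bool using (Bool; true; false; T; _xor_; not; if_then_else_)
open import Data.Bool.Properties using (T-∧; not-¬; ¬-not; not-injective; not-involutive)
  renaming (_≟_ to _≟ᵇ_)
open import Data.Vec using (lookup; tabulate; _∷_; _[_]≔_)
open import Data.Vec.Properties using (lookup∘tabulate; lookup∘update; lookup∘update′)
open import Data.Product using (Σ; _×_; _,_; proj₁; proj₂)
open import Data.Sum using (_⊎_; inj₁; inj₂)
open import Data.Empty using (⊥-elim)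
open import Data.Unit using (tt)
open import Data.List.Membership.Propositional using (_∈_)
open import Data.List.Relation.Unary.Any using (here; there)
import Data.List.Relation.Unary.All as All
open import Data.List.Relation.Unary.All.Properties using (¬Any⇒All¬)
open import Data.List.Relation.Unary.AllPairs using ([]; _∷_)
open import Function using (_∘_)
open import Function.Bundles using (Equivalence)
open import Relation.Binary.PropositionalEquality
  using (_≡_; _≢_; refl; sym; trans; cong; subst; subst₂; module ≡-Reasoning)
open import Relation.Nullary using (¬_; yes; no; does)
open import Relation.Nullary.Decidable using (_×-dec_; _⊎-dec_; map′; dec-true; dec-false)
open import Relation.Nullary.Decidable.Core using (T?)
open import Relation.Unary using (Decidable)

-- Colour p alternately, starting with b at v, and let R₀ be its vertices of colour true.
-- As p is shortest, an edge of G joins only consecutive vertices of p, so R₀ is independent;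
-- p alternates between R₀ and its complement and joins v to every member of R₀ in
-- G(R₀, V ∖ R₀). Now grow R greedily. Call a vertex covered if it is v, lies in R or has a
-- neighbour in R. While some vertex is uncovered, connectivity of G gives an edge from a
-- covered vertex y to an uncovered vertex x, and R ∪ {x} is still independent, agrees with R
-- on the covered vertices (so p still alternates and v keeps its side) and joins v to x through
-- y in the bipartite graph, hence to every newly covered vertex. Once every vertex is
-- covered, every vertex is joined to v in G(R, V ∖ R).

xor-≢ : ∀ {x y} → x ≢ y → T (x xor y)
xor-≢ {false} {false} x≢y = x≢y refl
xor-≢ {false} {true}  _   = tt
xor-≢ {true}  {false} _   = tt
xor-≢ {true}  {true}  x≢y = x≢y refl

T-xor⇒≢ : ∀ {x y} → T (x xor y) → x ≢ y
T-xor⇒≢ {false} {true}  _ ()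
T-xor⇒≢ {true}  {false} _ ()

isEven : ℕ → Bool
isEven zero = true
isEven (suc k) = not (isEven k)

isEven-injective-≤1+ : ∀ i j → j ≤ suc i → i ≤ suc j → isEven i ≡ isEven j → i ≡ j
isEven-injective-≤1+ zero zero _ _ _ = refl
isEven-injective-≤1+ zero (suc zero) _ _ ()
isEven-injective-≤1+ zero (suc (suc j)) (s≤s ()) _ _
isEven-injective-≤1+ (suc zero) zero _ _ ()
isEven-injective-≤1+ (suc (suc i)) zero _ (s≤s ()) _
isEven-injective-≤1+ (suc i) (suc j) (s≤s j≤1+i) (s≤s i≤1+j) same =
  cong suc (isEven-injective-≤1+ i j j≤1+i i≤1+j (not-injective same))

lookup-[]≔true : ∀ {n} (R : Subset n) {x u} → lookup (R [ x ]≔ true) u ≡ true → u ≡ x ⊎ lookup R u ≡ true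
lookup-[]≔true R {x} {u} u∈R′ with u ≟ x
... | yes u≡x = inj₁ u≡x
... | no u≢x = inj₂ (trans (sym (lookup∘update′ u≢x R true)) u∈R′)

∣p[x]≔true∣≡1+∣p∣ : ∀ {n} (R : Subset n) x → lookup R x ≡ false → ∣ R [ x ]≔ true ∣ ≡ suc ∣ R ∣
∣p[x]≔true∣≡1+∣p∣ (false ∷ R) Fin.zero refl = refl
∣p[x]≔true∣≡1+∣p∣ (true ∷ R) (Fin.suc x) x∉R = cong suc (∣p[x]≔true∣≡1+∣p∣ R x x∉R)
∣p[x]≔true∣≡1+∣p∣ (false ∷ R) (Fin.suc x) x∉R = ∣p[x]≔true∣≡1+∣p∣ R x x∉R

x∉p⇒∣p∣<n : ∀ {n} (R : Subset n) x → lookup R x ≡ false → ∣ R ∣ < n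
x∉p⇒∣p∣<n R x x∉R = subst (_≤ _) (∣p[x]≔true∣≡1+∣p∣ R x x∉R) (∣p∣≤n (R [ x ]≔ true))

module _ {n : ℕ} {A : Fin n → Fin n → Bool} where

  open import Data.List.Membership.DecPropositional (_≟_ {n}) using (_∈?_)

  infixr 5 _++ʷ_
  _++ʷ_ : ∀ {u v w} → Walk A u v → Walk A v w → Walk A u w
  [ _ ] ++ʷ q = q
  (u ∷⟨ e ⟩ p) ++ʷ q = u ∷⟨ e ⟩ (p ++ʷ q)

  len-++ʷ : ∀ {u v w} (p : Walk A u v) (q : Walk A v w) → len (p ++ʷ q) ≡ len p + len q
  len-++ʷ [ _ ] q = refl
  len-++ʷ (u ∷⟨ e ⟩ p) q = cong suc (len-++ʷ p q)

  reverseʷ : (∀ {u v} → T (A u v) → T (A v u)) → ∀ {u w} → Walk A u w → Walk A w u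
  reverseʷ A-sym [ v ] = [ v ]
  reverseʷ A-sym (_∷⟨_⟩_ u {v} e p) = reverseʷ A-sym p ++ʷ (v ∷⟨ A-sym e ⟩ [ u ])

  head∈vertices : ∀ {u w} (q : Walk A u w) → u ∈ vertices q
  head∈vertices [ v ] = here refl
  head∈vertices (u ∷⟨ _ ⟩ q) = here refl

  path-suffixFrom : ∀ {s u w} (q : Walk A s w) → IsPath q → u ∈ vertices q →
                    Σ (Walk A u w) λ q′ → IsPath q′ × len q′ ≤ len q
  path-suffixFrom [ t ] q-path (here refl) = [ t ] , q-path , z≤n
  path-suffixFrom (s ∷⟨ e ⟩ q) q-path (here refl) = (s ∷⟨ e ⟩ q) , q-path , ≤-refl
  path-suffixFrom (s ∷⟨ e ⟩ q) (_ ∷ q-path) (there u∈q) =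
    let q′ , q′-path , q′≤q = path-suffixFrom q q-path u∈q in q′ , q′-path , m≤n⇒m≤1+n q′≤q

  walk⇒path : ∀ {u w} (q : Walk A u w) → Σ (Walk A u w) λ q′ → IsPath q′ × len q′ ≤ len q
  walk⇒path [ v ] = [ v ] , (All.[] ∷ []) , z≤n
  walk⇒path (u ∷⟨ e ⟩ q) with walk⇒path q
  ... | q′ , q′-path , q′≤q with u ∈? vertices q′
  ... | yes u∈q′ = let q″ , q″-path , q″≤q′ = path-suffixFrom q′ q′-path u∈q′
                   in q″ , q″-path , m≤n⇒m≤1+n (≤-trans q″≤q′ q′≤q)
  ... | no u∉q′ = (u ∷⟨ e ⟩ q′) , (¬Any⇒All¬ _ u∉q′ ∷ q′-path) , s≤s q′≤q

  shortestPath-minimal : ∀ {u w} {p : Walk A u w} → IsShortestPath p → (q : Walk A u w) → len p ≤ len q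
  shortestPath-minimal (_ , minimal) q =
    let q′ , q′-path , q′≤q = walk⇒path q in ≤-trans (minimal q′ q′-path) q′≤q

  vertexAt : ∀ {u w} → Walk A u w → ℕ → Fin n
  vertexAt [ v ] _ = v
  vertexAt (u ∷⟨ _ ⟩ q) zero = u
  vertexAt (u ∷⟨ _ ⟩ q) (suc i) = vertexAt q i

  prefix : ∀ {u w} (p : Walk A u w) (i : ℕ) → Walk A u (vertexAt p i)
  prefix [ v ] i = [ v ]
  prefix (u ∷⟨ _ ⟩ q) zero = [ u ]
  prefix (u ∷⟨ e ⟩ q) (suc i) = u ∷⟨ e ⟩ prefix q i

  suffix : ∀ {u w} (p : Walk A u w) (j : ℕ) → Walk A (vertexAt p j) w
  suffix [ v ] j = [ v ]
  suffix (u ∷⟨ e ⟩ q) zero = u ∷⟨ e ⟩ q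
  suffix (u ∷⟨ _ ⟩ q) (suc j) = suffix q j

  len-prefix : ∀ {u w} (p : Walk A u w) i → len (prefix p i) ≤ i
  len-prefix [ v ] i = z≤n
  len-prefix (u ∷⟨ _ ⟩ q) zero = z≤n
  len-prefix (u ∷⟨ e ⟩ q) (suc i) = s≤s (len-prefix q i)

  len-suffix : ∀ {u w} (p : Walk A u w) j → len (suffix p j) ≡ len p ∸ j
  len-suffix [ v ] zero = refl
  len-suffix [ v ] (suc j) = refl
  len-suffix (u ∷⟨ e ⟩ q) zero = refl
  len-suffix (u ∷⟨ _ ⟩ q) (suc j) = len-suffix q j

  shortestPath-chord : ∀ {u w} {p : Walk A u w} → IsShortestPath p → ∀ i j →
                       T (A (vertexAt p i) (vertexAt p j)) → j ≤ len p → j ≤ suc i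
  shortestPath-chord {u} {w} {p} shortest i j e j≤len = +-cancelˡ-≤ d j (suc i) (begin
    d + j                                     ≡⟨ m∸n+n≡m j≤len ⟩
    len p                                     ≤⟨ shortestPath-minimal shortest shortcut ⟩
    len shortcut                              ≡⟨ len-++ʷ (prefix p i) _ ⟩
    len (prefix p i) + suc (len (suffix p j)) ≤⟨ +-mono-≤ (len-prefix p i) (s≤s (≤-reflexive (len-suffix p j))) ⟩
    i + suc d                                 ≡⟨ +-comm i (suc d) ⟩
    suc (d + i)                               ≡⟨ sym (+-suc d i) ⟩
    d + suc i                                 ∎)
    where
    open ≤-Reasoning
    d : ℕ
    d = len p ∸ j
    shortcut : Walk A u w
    shortcut = prefix p i ++ʷ (vertexAt p i ∷⟨ e ⟩ suffix p j)

  boundaryEdge : ∀ {P : Fin n → Set} → Decidable P → ∀ {s z} → Walk A s z → P s → ¬ P z →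
                 Σ (Fin n) λ y → Σ (Fin n) λ x → P y × ¬ P x × T (A y x)
  boundaryEdge P? [ s ] Ps ¬Pz = ⊥-elim (¬Pz Ps)
  boundaryEdge P? (_∷⟨_⟩_ s {t} e q) Ps ¬Pz with P? t
  ... | yes Pt = boundaryEdge P? q Pt ¬Pz
  ... | no ¬Pt = s , t , Ps , ¬Pt , e

  alternatingColouring : ∀ {u w} → Walk A u w → Bool → Fin n → Bool
  alternatingColouring [ u ] b x = if does (x ≟ u) then b else false
  alternatingColouring (u ∷⟨ _ ⟩ q) b x =
    if does (x ≟ u) then b else alternatingColouring q (not b) x

  alternatingColouring-head : ∀ {u w} (p : Walk A u w) b → alternatingColouring p b u ≡ b
  alternatingColouring-head {u} [ _ ] b rewrite dec-true (u ≟ u) refl = refl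
  alternatingColouring-head {u} (_ ∷⟨ _ ⟩ _) b rewrite dec-true (u ≟ u) refl = refl

  alternatingColouring-∷ : ∀ {u v w x} (e : T (A u v)) (q : Walk A v w) b → x ≢ u →
                           alternatingColouring (u ∷⟨ e ⟩ q) b x ≡ alternatingColouring q (not b) x
  alternatingColouring-∷ {u} {x = x} e q b x≢u rewrite dec-false (x ≟ u) x≢u = refl

  alternatingColouring-true⇒position : ∀ {u w} (p : Walk A u w) b x → alternatingColouring p b x ≡ true →
                                       Σ ℕ λ i → vertexAt p i ≡ x × i ≤ len p × isEven i ≡ b
  alternatingColouring-true⇒position {u} [ _ ] b x coloured with x ≟ u
  ... | yes refl = 0 , refl , z≤n , sym coloured
  ... | no _ with () ← coloured
  alternatingColouring-true⇒position {u} (_ ∷⟨ _ ⟩ q) b x coloured with x ≟ u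
  ... | yes refl = 0 , refl , z≤n , sym coloured
  ... | no _ = let i , at-i , i≤len , parity = alternatingColouring-true⇒position q (not b) x coloured
               in suc i , at-i , s≤s i≤len , trans (cong not parity) (not-involutive b)

  alternatingColouring-alternates : ∀ {u w} (q : Walk A u w) b (R : Subset n) → IsPath q →
                                    (∀ x → x ∈ vertices q → lookup R x ≡ alternatingColouring q b x) →
                                    Alternates R q
  alternatingColouring-alternates [ u ] b R _ _ = tt
  alternatingColouring-alternates (_∷⟨_⟩_ u {v} e q) b R (u∉q ∷ q-path) R≡colour =
    R-u≢R-v , alternatingColouring-alternates q (not b) R q-path R≡colour′
    where
    R≡colour′ : ∀ x → x ∈ vertices q → lookup R x ≡ alternatingColouring q (not b) x
    R≡colour′ x x∈q =
      trans (R≡colour x (there x∈q)) (alternatingColouring-∷ e q b (λ x≡u → All.lookup u∉q x∈q (sym x≡u)))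
    R-u≢R-v : lookup R u ≢ lookup R v
    R-u≢R-v eq = not-¬ refl (begin
      b                                     ≡⟨ alternatingColouring-head (u ∷⟨ e ⟩ q) b ⟨
      alternatingColouring (u ∷⟨ e ⟩ q) b u ≡⟨ R≡colour u (here refl) ⟨
      lookup R u                            ≡⟨ eq ⟩
      lookup R v                            ≡⟨ R≡colour′ v (head∈vertices q) ⟩
      alternatingColouring q (not b) v      ≡⟨ alternatingColouring-head q (not b) ⟩
      not b                                 ∎)
      where open ≡-Reasoning

  Alternates-cong : ∀ {R R′ u w} (q : Walk A u w) → (∀ x → x ∈ vertices q → lookup R′ x ≡ lookup R x) →
                    Alternates R q → Alternates R′ q
  Alternates-cong [ v ] _ _ = tt
  Alternates-cong (_∷⟨_⟩_ u {v} e q) R′≡R (ne , alt) =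
    (λ eq → ne (trans (sym (R′≡R u (here refl))) (trans eq (R′≡R v (there (head∈vertices q)))))) ,
    Alternates-cong q (λ x x∈q → R′≡R x (there x∈q)) alt

  Alternates-prefix : ∀ R {u w} (p : Walk A u w) → Alternates R p → ∀ i → Alternates R (prefix p i)
  Alternates-prefix R [ v ] _ i = tt
  Alternates-prefix R (u ∷⟨ e ⟩ q) _ zero = tt
  Alternates-prefix R (u ∷⟨ e ⟩ q) (ne , alt) (suc i) = ne , Alternates-prefix R q alt i

module _ {n : ℕ} (G : SimpleGraph n) where

  adj-sym : ∀ {u v} → T (adj G u v) → T (adj G v u)
  adj-sym {u} {v} = subst T (SimpleGraph.sym G u v)

  adj-irrefl : ∀ {u v} → T (adj G u v) → u ≢ v
  adj-irrefl {u} e refl = subst T (loopless G u) e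

  bipAdj-intro : ∀ R {u v} → T (adj G u v) → lookup R u ≢ lookup R v → T (bipAdj G R u v)
  bipAdj-intro R e ne = Equivalence.from T-∧ (e , xor-≢ ne)

  bipAdj-elim : ∀ R {u v} → T (bipAdj G R u v) → T (adj G u v) × lookup R u ≢ lookup R v
  bipAdj-elim R e = let e′ , sides = Equivalence.to T-∧ e in e′ , T-xor⇒≢ sides

  bipAdj-sym : ∀ R {u v} → T (bipAdj G R u v) → T (bipAdj G R v u)
  bipAdj-sym R e = let e′ , ne = bipAdj-elim R e in bipAdj-intro R (adj-sym e′) (ne ∘ sym)

  alternating⇒bipWalk : ∀ R {u w} (p : Walk (adj G) u w) → Alternates R p → Walk (bipAdj G R) u w
  alternating⇒bipWalk R [ v ] _ = [ v ]
  alternating⇒bipWalk R (u ∷⟨ e ⟩ q) (ne , alt) = u ∷⟨ bipAdj-intro R e ne ⟩ alternating⇒bipWalk R q alt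

  shortestPath-colouring-independent : ∀ {u w} {p : Walk (adj G) u w} → IsShortestPath p → ∀ b →
                                       Independent G (tabulate (alternatingColouring p b))
  shortestPath-colouring-independent {p = p} shortest b x y x∈R y∈R e = adj-irrefl e x≡y
    where
    position : ∀ z → lookup (tabulate (alternatingColouring p b)) z ≡ true →
               Σ ℕ λ i → vertexAt p i ≡ z × i ≤ len p × isEven i ≡ b
    position z z∈R = alternatingColouring-true⇒position p b z (trans (sym (lookup∘tabulate _ z)) z∈R)
    x≡y : x ≡ y
    x≡y =
      let i , at-i , i≤len , even-i = position x x∈R
          j , at-j , j≤len , even-j = position y y∈R
          chord = subst₂ (λ s t → T (adj G s t)) (sym at-i) (sym at-j) e
          i≡j = isEven-injective-≤1+ i j (shortestPath-chord shortest i j chord j≤len)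
                  (shortestPath-chord shortest j i (adj-sym chord) i≤len) (trans even-i (sym even-j))
      in trans (sym at-i) (trans (cong (vertexAt p) i≡j) at-j)

  module Greedy (connected : Connected G) (a : Fin n) where

    data Covered (R : Subset n) (u : Fin n) : Set where
      member    : lookup R u ≡ true → Covered R u
      neighbour : ∀ {r} → lookup R r ≡ true → T (adj G r u) → Covered R u
      root      : u ≡ a → Covered R u  -- so that a is never inserted and keeps its side

    covered? : ∀ R → Decidable (Covered R)
    covered? R u = map′
      (λ { (inj₁ u∈R) → member u∈R
         ; (inj₂ (inj₁ (_ , r∈R , e))) → neighbour r∈R e
         ; (inj₂ (inj₂ u≡a)) → root u≡a })
      (λ { (member u∈R) → inj₁ u∈R
         ; (neighbour r∈R e) → inj₂ (inj₁ (_ , r∈R , e))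
         ; (root u≡a) → inj₂ (inj₂ u≡a) })
      ((lookup R u ≟ᵇ true) ⊎-dec (any? (λ r → (lookup R r ≟ᵇ true) ×-dec T? (adj G r u)) ⊎-dec (u ≟ a)))

    differentSides⇒Covered : ∀ {R s t} → T (adj G s t) → lookup R s ≢ lookup R t → Covered R t
    differentSides⇒Covered {R} {s} {t} e ne with lookup R t in t∈R
    ... | true = member t∈R
    ... | false = neighbour (¬-not ne) e

    alternating⇒Covered : ∀ {R s w} (q : Walk (adj G) s w) → Alternates R q → Covered R s →
                          ∀ x → x ∈ vertices q → Covered R x
    alternating⇒Covered [ t ] _ cs x (here refl) = cs
    alternating⇒Covered (s ∷⟨ e ⟩ q) _ cs x (here refl) = cs
    alternating⇒Covered (s ∷⟨ e ⟩ q) (ne , alt) cs x (there x∈q) =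
      alternating⇒Covered q alt (differentSides⇒Covered e ne) x x∈q

    Agrees : Subset n → Subset n → Set
    Agrees R R′ = ∀ u → Covered R u → lookup R′ u ≡ lookup R u

    Covered-mono : ∀ {R R′ u} → Agrees R R′ → Covered R u → Covered R′ u
    Covered-mono {u = u} agrees (member u∈R) = member (trans (agrees u (member u∈R)) u∈R)
    Covered-mono agrees (neighbour {r} r∈R e) = neighbour (trans (agrees r (member r∈R)) r∈R) e
    Covered-mono agrees (root u≡a) = root u≡a

    Agrees-trans : ∀ {R R′ R″} → Agrees R R′ → Agrees R′ R″ → Agrees R R″
    Agrees-trans agrees agrees′ u cu = trans (agrees′ u (Covered-mono agrees cu)) (agrees u cu)

    bipWalk-transport : ∀ {R R′} → Agrees R R′ → ∀ {s t} → Walk (bipAdj G R) s t → Walk (bipAdj G R′) s t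
    bipWalk-transport agrees [ t ] = [ t ]
    bipWalk-transport {R} {R′} agrees (_∷⟨_⟩_ s {t} e q) =
      s ∷⟨ bipAdj-intro R′ e′ R′-sides ⟩ bipWalk-transport {R′ = R′} agrees q
      where
      e′ : T (adj G s t)
      e′ = proj₁ (bipAdj-elim R e)
      R′-sides : lookup R′ s ≢ lookup R′ t
      R′-sides eq = proj₂ (bipAdj-elim R e) (begin
        lookup R s  ≡⟨ agrees s (differentSides⇒Covered (adj-sym e′) (proj₂ (bipAdj-elim R e) ∘ sym)) ⟨
        lookup R′ s ≡⟨ eq ⟩
        lookup R′ t ≡⟨ agrees t (differentSides⇒Covered e′ (proj₂ (bipAdj-elim R e))) ⟩
        lookup R t  ∎)
        where open ≡-Reasoning

    Reaches : Subset n → Set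
    Reaches R = ∀ u → Covered R u → Walk (bipAdj G R) a u

    membersReach⇒Reaches : ∀ {R} → Independent G R → (∀ u → lookup R u ≡ true → Walk (bipAdj G R) a u) →
                           Reaches R
    membersReach⇒Reaches ind reach u (member u∈R) = reach u u∈R
    membersReach⇒Reaches {R} ind reach u (neighbour {r} r∈R e) =
      reach r r∈R ++ʷ (r ∷⟨ bipAdj-intro R e (λ eq → ind r u r∈R (trans (sym eq) r∈R) e) ⟩ [ u ])
    membersReach⇒Reaches ind reach u (root refl) = [ a ]

    module _ {R : Subset n} {x : Fin n} (x-uncovered : ¬ Covered R x) where

      x∉R : lookup R x ≡ false
      x∉R = ¬-not (x-uncovered ∘ member)

      insert-agrees : Agrees R (R [ x ]≔ true)
      insert-agrees u cu = lookup∘update′ (λ u≡x → x-uncovered (subst (Covered R) u≡x cu)) R true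

      insert-independent : Independent G R → Independent G (R [ x ]≔ true)
      insert-independent ind u v u∈R′ v∈R′ e with lookup-[]≔true R u∈R′ | lookup-[]≔true R v∈R′
      ... | inj₁ refl | inj₁ refl = adj-irrefl e refl
      ... | inj₁ refl | inj₂ v∈R = x-uncovered (neighbour v∈R (adj-sym e))
      ... | inj₂ u∈R | inj₁ refl = x-uncovered (neighbour u∈R e)
      ... | inj₂ u∈R | inj₂ v∈R = ind u v u∈R v∈R e

      insert-reaches : Independent G R → Reaches R → ∀ {y} → Covered R y → T (adj G y x) →
                       Reaches (R [ x ]≔ true)
      insert-reaches ind reach {y} cy e = membersReach⇒Reaches (insert-independent ind) membersReach
        where
        y-x-sides : lookup (R [ x ]≔ true) y ≢ lookup (R [ x ]≔ true) x
        y-x-sides eq =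
          x-uncovered (neighbour (trans (sym (insert-agrees y cy)) (trans eq (lookup∘update x R true))) e)
        membersReach : ∀ u → lookup (R [ x ]≔ true) u ≡ true → Walk (bipAdj G (R [ x ]≔ true)) a u
        membersReach u u∈R′ with lookup-[]≔true R u∈R′
        ... | inj₁ refl = bipWalk-transport {R′ = R [ x ]≔ true} insert-agrees (reach y cy)
                            ++ʷ (y ∷⟨ bipAdj-intro (R [ x ]≔ true) e y-x-sides ⟩ [ x ])
        ... | inj₂ u∈R = bipWalk-transport {R′ = R [ x ]≔ true} insert-agrees (reach u (member u∈R))

    insertBoundaryVertex : ∀ {R} → Independent G R → Reaches R → ¬ (∀ u → Covered R u) →
                           Σ (Fin n) λ x → lookup R x ≡ false × Independent G (R [ x ]≔ true) ×
                             Reaches (R [ x ]≔ true) × Agrees R (R [ x ]≔ true)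
    insertBoundaryVertex {R} ind reach notAll =
      let z , z-uncovered = ¬∀⟶∃¬ n (Covered R) (covered? R) notAll
          y , x , y-covered , x-uncovered , e = boundaryEdge (covered? R) (connected a z) (root refl) z-uncovered
      in x , x∉R x-uncovered , insert-independent x-uncovered ind ,
         insert-reaches x-uncovered ind reach y-covered e , insert-agrees x-uncovered

    Extension : Subset n → Set
    Extension R = Σ (Subset n) λ R′ → Independent G R′ × (∀ u → Walk (bipAdj G R′) a u) × Agrees R R′

    extend : ∀ k R → n ≤ ∣ R ∣ + k → Independent G R → Reaches R → Extension R
    extend k R bound ind reach with all? (covered? R)
    ... | yes allCovered = R , ind , (λ u → reach u (allCovered u)) , (λ _ _ → refl)
    ... | no notAll with insertBoundaryVertex ind reach notAll | k
    ... | x , x∉R , _ , _ , _ | zero =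
      ⊥-elim (<⇒≱ (x∉p⇒∣p∣<n R x x∉R) (subst (n ≤_) (+-identityʳ ∣ R ∣) bound))
    ... | x , x∉R , ind′ , reach′ , agrees | suc k′ =
      let R″ , ind″ , reach″ , agrees′ = extend k′ (R [ x ]≔ true) bound′ ind′ reach′
      in R″ , ind″ , reach″ , Agrees-trans {R′ = R [ x ]≔ true} {R″} agrees agrees′
      where
      bound′ : n ≤ ∣ R [ x ]≔ true ∣ + k′
      bound′ = subst (n ≤_) (trans (+-suc ∣ R ∣ k′) (cong (_+ k′) (sym (∣p[x]≔true∣≡1+∣p∣ R x x∉R)))) bound

    spanningExtension : ∀ {R} → Independent G R → Reaches R → Extension R
    spanningExtension {R} = extend n R (m≤n+m n ∣ R ∣)

lemma1 : (n : ℕ) (G : SimpleGraph n) → Connected G →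
         (v w : Fin n) (p : Walk (adj G) v w) → IsShortestPath p →
         (b : Bool) →
         Σ (Subset n) λ R →
           Independent G R × (lookup R v ≡ b) ×
           ConnectedAdj (bipAdj G R) × Alternates R p
lemma1 n G connected v w p shortest b =
  let R , independent , reach , agrees = spanningExtension R₀-independent R₀-reaches
  in R , independent , trans (agrees v (root refl)) R₀-v ,
     (λ u₁ u₂ → reverseʷ (bipAdj-sym G R) (reach u₁) ++ʷ reach u₂) ,
     Alternates-cong p (λ x x∈p → agrees x (alternating⇒Covered p R₀-alternates (root refl) x x∈p)) R₀-alternates
  where
  open Greedy G connected v

  R₀ : Subset n
  R₀ = tabulate (alternatingColouring p b)

  R₀-v : lookup R₀ v ≡ b
  R₀-v = trans (lookup∘tabulate _ v) (alternatingColouring-head p b)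

  R₀-independent : Independent G R₀
  R₀-independent = shortestPath-colouring-independent G shortest b

  R₀-alternates : Alternates R₀ p
  R₀-alternates = alternatingColouring-alternates p b R₀ (proj₁ shortest) (λ x _ → lookup∘tabulate _ x)

  R₀-reaches : Reaches R₀
  R₀-reaches = membersReach⇒Reaches R₀-independent λ u u∈R₀ →
    let i , at-i , _ , _ = alternatingColouring-true⇒position p b u (trans (sym (lookup∘tabulate _ u)) u∈R₀)
    in subst (Walk (bipAdj G R₀) v) at-i
         (alternating⇒bipWalk G R₀ (prefix p i) (Alternates-prefix R₀ p R₀-alternates i))
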